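{- Let $d\geq 3$, let $G$ be a $d$-regular graph and $v$ a vertex of $G$, layered from $v$. Let $x,y\in V_1$ with $xy$ an edge and $\mathrm{od}(y)\geq 1$. Then there is a $\Delta$-switch transforming $G$ into a graph $G'$ with ${\rm N}_{G'}(v)={\rm N}_G(v)$ in which $xy$ is not an edge, the edges of $G[V_2]$ are unchanged, and the number of edges of $G'[V_1]$ is at least $|E_1|$.
   Context: All graphs are simple. Layering from $v$: let $C$ be the component of $G$ containing $v$; for $i\ge0$, $V_i$ is the set of vertices of $C$ at distance exactly $i$ from $v$ (so $V_1={\rm N}(v)$); $E_i$ is the edge set of $G[V_i]$. For $u\in V_i$, $\mathrm{od}(u)=|{\rm N}(u)\cap V_{i+1}|$. A $\Delta^+$-switch: if $p,x,y,w,z$ are distinct vertices with $yx, xp, pw, wz\in E$ and $xw, yz\notin E$, delete $xy$, $wz$ and insert $xw$, $yz$. A $\Delta^-$-switch is the reverse: if $p,x,y,w,z$ are distinct, $G$ contains the triangle $p,x,w$ and the edge $yz$, and $xy,wz\notin E$, delete $xw$, $yz$ and insert $xy$, $wz$. A $\Delta$-switch is either of these. -}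

module Defs where

open import Data.Nat using (ℕ; zero; suc; _+_; _<ᵇ_)
open import Data.Fin using (Fin; toℕ)
open import Data.Bool using (Bool; true; false; _∧_; if_then_else_)
open import Data.Product using (Σ; _×_; ∃; ∃-syntax; _,_)
open import Data.Sum using (_⊎_)
open import Relation.Nullary using (¬_)
open import Relation.Binary.PropositionalEquality using (_≡_; _≢_)

record Graph (n : ℕ) : Set where
  field
    adj    : Fin n → Fin n → Bool
    sym    : ∀ a b → adj a b ≡ adj b a
    irrefl : ∀ a → adj a a ≡ false
open Graph public

Edge : ∀ {n} → Graph n → Fin n → Fin n → Set
Edge G a b = adj G a b ≡ true

sumFin : ∀ n → (Fin n → ℕ) → ℕ
sumFin zero    f = 0
sumFin (suc n) f = f Fin.zero + sumFin n (λ i → f (Fin.suc i))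

b2n : Bool → ℕ
b2n true  = 1
b2n false = 0

countFin : ∀ n → (Fin n → Bool) → ℕ
countFin n P = sumFin n (λ i → b2n (P i))

degree : ∀ {n} → Graph n → Fin n → ℕ
degree {n} G u = countFin n (adj G u)

Regular : ∀ {n} → Graph n → ℕ → Set
Regular G d = ∀ u → degree G u ≡ d

data Walk {n} (G : Graph n) : Fin n → Fin n → ℕ → Set where
  here : ∀ {a} → Walk G a a 0
  step : ∀ {a b c k} → Edge G a b → Walk G b c k → Walk G a c (suc k)

-- u is at distance exactly i from v (i.e. u ∈ V_i of the layering from v)
AtDist : ∀ {n} → Graph n → Fin n → ℕ → Fin n → Set
AtDist G v i u = Walk G v u i × (∀ j → Data.Nat._<_ j i → ¬ Walk G v u j)

-- |E_1| : number of edges of G[N(v)] (unordered pairs counted once)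
edgesInNbhd : ∀ {n} → Graph n → Fin n → ℕ
edgesInNbhd {n} G v =
  sumFin n (λ a → countFin n (λ b →
    (toℕ a <ᵇ toℕ b) ∧ adj G v a ∧ adj G v b ∧ adj G a b))

SamePair : ∀ {n} → Fin n → Fin n → Fin n → Fin n → Set
SamePair a b c d = (a ≡ c × b ≡ d) ⊎ (a ≡ d × b ≡ c)

Distinct5 : ∀ {n} → Fin n → Fin n → Fin n → Fin n → Fin n → Set
Distinct5 p x y w z =
  p ≢ x × p ≢ y × p ≢ w × p ≢ z × x ≢ y × x ≢ w × x ≢ z × y ≢ w × y ≢ z × w ≢ z

Replace : ∀ {n} → Graph n → Graph n →
          (d1a d1b d2a d2b i1a i1b i2a i2b : Fin n) → Set
Replace G G' d1a d1b d2a d2b i1a i1b i2a i2b =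
  ∀ a b → (Edge G' a b →
             (Edge G a b × ¬ SamePair a b d1a d1b × ¬ SamePair a b d2a d2b)
             ⊎ SamePair a b i1a i1b ⊎ SamePair a b i2a i2b)
        × ((Edge G a b × ¬ SamePair a b d1a d1b × ¬ SamePair a b d2a d2b)
             ⊎ SamePair a b i1a i1b ⊎ SamePair a b i2a i2b → Edge G' a b)

DeltaPlus : ∀ {n} → Graph n → Graph n → Set
DeltaPlus {n} G G' = Σ (Fin n) λ p → Σ (Fin n) λ x → Σ (Fin n) λ y →
  Σ (Fin n) λ w → Σ (Fin n) λ z →
    Distinct5 p x y w z
  × Edge G y x × Edge G x p × Edge G p w × Edge G w z
  × ¬ Edge G x w × ¬ Edge G y z
  × Replace G G' x y w z x w y z

DeltaMinus : ∀ {n} → Graph n → Graph n → Set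
DeltaMinus {n} G G' = Σ (Fin n) λ p → Σ (Fin n) λ x → Σ (Fin n) λ y →
  Σ (Fin n) λ w → Σ (Fin n) λ z →
    Distinct5 p x y w z
  × Edge G p x × Edge G x w × Edge G w p × Edge G y z
  × ¬ Edge G x y × ¬ Edge G w z
  × Replace G G' x w y z x y w z

DeltaSwitch : ∀ {n} → Graph n → Graph n → Set
DeltaSwitch G G' = DeltaPlus G G' ⊎ DeltaMinus G G'

module Submission where

open import Defs hiding (sym; irrefl)
open import Data.Bool using (Bool; true; false; _∧_; _∨_; not)
import Data.Bool as Bool
open import Data.Bool.Properties
  using (∧-assoc; ∧-comm; ∧-identityʳ; ∧-zeroʳ; ∨-comm; ∨-zeroʳ; ∨-identityʳ; ¬-not)
open import Data.Fin using (Fin; toℕ; zero; suc)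
open import Data.Fin.Properties using (_≟_; any?; toℕ-injective)
open import Data.Nat using (ℕ; zero; suc; _+_; _*_; _≤_; _<_; _≥_; _<ᵇ_; z≤n; s≤s)
open import Data.Nat.Properties hiding (_≟_)
open import Algebra.Properties.CommutativeSemigroup +-commutativeSemigroup using (interchange; x∙yz≈y∙xz)
open import Data.Nat.Tactic.RingSolver using (solve-∀)
open import Data.Product using (Σ; _×_; ∃; _,_)
open import Data.Sum using (_⊎_; inj₁; inj₂; [_,_])
open import Function.Base using (_∘_)
open import Function.Bundles using (_⇔_; mk⇔)
open import Relation.Nullary using (¬_; Dec; yes; no; does; contradiction)
open import Relation.Nullary.Decidable using (_×-dec_; _⊎-dec_; dec-true; dec-false)
open import Relation.Binary.PropositionalEquality
  using (_≡_; _≢_; refl; sym; trans; cong; cong₂; ≢-sym; module ≡-Reasoning)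

-- Since |N(v) ∖ {y}| = d − 1 exceeds |N(y) ∖ {v, u}| = d − 2, some w ∈ N(v) ∖ {y} is not
-- adjacent to y (so w ≠ x). Likewise |N(w) ∖ {v, x}| exceeds |N(x) ∖ {v, y, w}| by one, which
-- gives z ∈ N(w) ∖ {v, x} not adjacent to x. The Δ⁻-switch on the triangle v y x and the edge
-- wz deletes yx, wz and inserts yw, xz. It touches neither v nor V₂, and within N(v) it trades
-- yx for yw and, exactly when z ∈ N(v), wz for xz; so |E₁| does not change.

b2n-∧ : ∀ p q → b2n (p ∧ q) ≡ b2n p * b2n q
b2n-∧ true  q = sym (+-identityʳ (b2n q))
b2n-∧ false q = refl

b2n-∨ : ∀ p q → (p ≡ true → q ≡ false) → b2n (p ∨ q) ≡ b2n p + b2n q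
b2n-∨ true  true  p⇒¬q with () ← p⇒¬q refl
b2n-∨ true  false _ = refl
b2n-∨ false q     _ = refl

b2n-mono : ∀ {p q} → (p ≡ true → q ≡ true) → b2n p ≤ b2n q
b2n-mono {false}          _ = z≤n
b2n-mono {true}  {true}   _ = ≤-refl
b2n-mono {true}  {false} p⇒q with () ← p⇒q refl

b2n-<ᵇ-connex : ∀ m n → m ≢ n → b2n (m <ᵇ n) + b2n (n <ᵇ m) ≡ 1
b2n-<ᵇ-connex zero    zero    m≢n = contradiction refl m≢n
b2n-<ᵇ-connex zero    (suc n) _   = refl
b2n-<ᵇ-connex (suc m) zero    _   = refl
b2n-<ᵇ-connex (suc m) (suc n) m≢n = b2n-<ᵇ-connex m n (λ m≡n → m≢n (cong suc m≡n))

does⇒witness : ∀ {p} {P : Set p} (P? : Dec P) → does P? ≡ true → P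
does⇒witness (yes p) _ = p

b2n-switch : ∀ A D I → (D ≡ true → A ≡ true) → (I ≡ true → A ≡ false) →
             b2n ((A ∧ not D) ∨ I) + b2n D ≡ b2n A + b2n I
b2n-switch true  true  false _   _    = refl
b2n-switch true  false false _   _    = refl
b2n-switch true  _     true  _   I⇒¬A with () ← I⇒¬A refl
b2n-switch false true  _     D⇒A _    with () ← D⇒A refl
b2n-switch false false true  _   _    = refl
b2n-switch false false false _   _    = refl

sumFin-cong : ∀ n {f g : Fin n → ℕ} → (∀ i → f i ≡ g i) → sumFin n f ≡ sumFin n g
sumFin-cong zero    f≗g = refl
sumFin-cong (suc n) f≗g = cong₂ _+_ (f≗g zero) (sumFin-cong n (λ i → f≗g (suc i)))

sumFin-+ : ∀ n (f g : Fin n → ℕ) → sumFin n (λ i → f i + g i) ≡ sumFin n f + sumFin n g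
sumFin-+ zero    f g = refl
sumFin-+ (suc n) f g =
  trans (cong (f zero + g zero +_) (sumFin-+ n (λ i → f (suc i)) (λ i → g (suc i))))
        (interchange (f zero) (g zero) _ _)

sumFin-*ˡ : ∀ n k (f : Fin n → ℕ) → sumFin n (λ i → k * f i) ≡ k * sumFin n f
sumFin-*ˡ zero    k f = sym (*-zeroʳ k)
sumFin-*ˡ (suc n) k f =
  trans (cong (k * f zero +_) (sumFin-*ˡ n k (λ i → f (suc i))))
        (sym (*-distribˡ-+ k (f zero) _))

indicator : ∀ {n} → Fin n → Fin n → ℕ
indicator i c = b2n (does (i ≟ c))

sumFin-indicator : ∀ n (c : Fin n) (f : Fin n → ℕ) → sumFin n (λ i → indicator i c * f i) ≡ f c
sumFin-indicator (suc n) zero    f =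
  trans (cong₂ _+_ (*-identityˡ (f zero)) (sumFin-*ˡ n 0 (λ i → f (suc i)))) (+-identityʳ (f zero))
sumFin-indicator (suc n) (suc c) f = sumFin-indicator n c (λ i → f (suc i))

sumFin² : ∀ n → (Fin n → Fin n → ℕ) → ℕ
sumFin² n f = sumFin n λ a → sumFin n λ b → f a b

sumFin²-cong : ∀ n {f g : Fin n → Fin n → ℕ} → (∀ a b → f a b ≡ g a b) → sumFin² n f ≡ sumFin² n g
sumFin²-cong n f≗g = sumFin-cong n (λ a → sumFin-cong n (f≗g a))

sumFin²-+ : ∀ n (f g : Fin n → Fin n → ℕ) →
            sumFin² n (λ a b → f a b + g a b) ≡ sumFin² n f + sumFin² n g
sumFin²-+ n f g = trans (sumFin-cong n (λ a → sumFin-+ n (f a) (g a))) (sumFin-+ n _ _)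

sumFin²-indicator : ∀ n (c d : Fin n) (f : Fin n → Fin n → ℕ) →
                    sumFin² n (λ a b → indicator a c * (indicator b d * f a b)) ≡ f c d
sumFin²-indicator n c d f = begin
  sumFin n (λ a → sumFin n (λ b → indicator a c * (indicator b d * f a b)))
    ≡⟨ sumFin-cong n (λ a → sumFin-*ˡ n (indicator a c) (λ b → indicator b d * f a b)) ⟩
  sumFin n (λ a → indicator a c * sumFin n (λ b → indicator b d * f a b))
    ≡⟨ sumFin-indicator n c _ ⟩
  sumFin n (λ b → indicator b d * f c b)
    ≡⟨ sumFin-indicator n d _ ⟩
  f c d ∎
  where open ≡-Reasoning

_⊆_ : ∀ {n} → (Fin n → Bool) → (Fin n → Bool) → Set
P ⊆ Q = ∀ i → P i ≡ true → Q i ≡ true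

countFin-mono : ∀ n {P Q : Fin n → Bool} → P ⊆ Q → countFin n P ≤ countFin n Q
countFin-mono zero    P⊆Q = z≤n
countFin-mono (suc n) P⊆Q =
  +-mono-≤ (b2n-mono (P⊆Q zero)) (countFin-mono n (λ i → P⊆Q (suc i)))

countFin-<⇒∃ : ∀ n {P Q : Fin n → Bool} → countFin n Q < countFin n P →
               ∃ λ i → P i ≡ true × Q i ≡ false
countFin-<⇒∃ n {P} {Q} Q<P with any? (λ i → P i Bool.≟ true ×-dec Q i Bool.≟ false)
... | yes witness = witness
... | no ∄ = contradiction (countFin-mono n P⊆Q) (<⇒≱ Q<P)
  where
  P⊆Q : P ⊆ Q
  P⊆Q i Pi with Q i in Qi
  ... | true  = refl
  ... | false = contradiction (i , Pi , Qi) ∄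

infixl 6 _∖_

_∖_ : ∀ {n} → (Fin n → Bool) → Fin n → (Fin n → Bool)
(P ∖ a) i = P i ∧ not (does (i ≟ a))

∖-≢ : ∀ {n} (P : Fin n → Bool) {a i : Fin n} → i ≢ a → (P ∖ a) i ≡ P i
∖-≢ P {a} {i} i≢a rewrite dec-false (i ≟ a) i≢a = ∧-identityʳ (P i)

∖-self : ∀ {n} (P : Fin n → Bool) {a : Fin n} → (P ∖ a) a ≡ false
∖-self P {a} rewrite dec-true (a ≟ a) refl = ∧-zeroʳ (P a)

∈-∖ : ∀ {n} (P : Fin n → Bool) {a i : Fin n} → (P ∖ a) i ≡ true → P i ≡ true × i ≢ a
∈-∖ P {a} {i} i∈P∖a = trans (sym (∖-≢ P i≢a)) i∈P∖a , i≢a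
  where
  i≢a : i ≢ a
  i≢a refl = contradiction (trans (sym (∖-self P)) i∈P∖a) λ ()

countFin-∖ : ∀ n (P : Fin n → Bool) (a : Fin n) → countFin n P ≡ b2n (P a) + countFin n (P ∖ a)
countFin-∖ (suc n) P zero = cong (b2n (P zero) +_) (sym (cong₂ _+_
  (cong b2n (∧-zeroʳ (P zero))) (sumFin-cong n (λ i → cong b2n (∧-identityʳ (P (suc i)))))))
countFin-∖ (suc n) P (suc a) = begin
  b2n (P zero) + countFin n (λ i → P (suc i))
    ≡⟨ cong (b2n (P zero) +_) (countFin-∖ n (λ i → P (suc i)) a) ⟩
  b2n (P zero) + (b2n (P (suc a)) + countFin n ((λ i → P (suc i)) ∖ a))
    ≡⟨ x∙yz≈y∙xz (b2n (P zero)) (b2n (P (suc a))) C ⟩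
  b2n (P (suc a)) + (b2n (P zero) + C)
    ≡⟨ cong (λ b → b2n (P (suc a)) + (b2n b + C)) (sym (∧-identityʳ (P zero))) ⟩
  b2n (P (suc a)) + countFin (suc n) (P ∖ suc a) ∎
  where
  open ≡-Reasoning
  C : ℕ
  C = countFin n ((λ i → P (suc i)) ∖ a)

countFin-∖-∈ : ∀ n (P : Fin n → Bool) {a : Fin n} → P a ≡ true →
               countFin n P ≡ suc (countFin n (P ∖ a))
countFin-∖-∈ n P {a} Pa = trans (countFin-∖ n P a) (cong (λ b → b2n b + countFin n (P ∖ a)) Pa)

module _ {n : ℕ} (G : Graph n) where

  Edge-sym : ∀ {a b} → Edge G a b → Edge G b a
  Edge-sym {a} {b} ab = trans (Graph.sym G b a) ab

  Edge⇒≢ : ∀ {a b} → Edge G a b → a ≢ b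
  Edge⇒≢ {a} aa refl = contradiction (trans (sym (Graph.irrefl G a)) aa) λ ()

  ≡false⇒¬Edge : ∀ {a b} → adj G a b ≡ false → ¬ Edge G a b
  ≡false⇒¬Edge ab≡false ab = contradiction (trans (sym ab≡false) ab) λ ()

  module _ {d : ℕ} (regular : Regular G d) where

    ∃-neighbour-outside-N[y] : ∀ {v y u} → Edge G v y → Edge G y u → u ≢ v → ¬ Edge G v u →
                               ∃ λ w → Edge G v w × w ≢ y × ¬ Edge G y w
    ∃-neighbour-outside-N[y] {v} {y} {u} vy yu u≢v ¬vu = outside (countFin-<⇒∃ n smaller)
      where
      N : Fin n → Fin n → Bool
      N = adj G
      N[v]∖y≡ : d ≡ suc (countFin n (N v ∖ y))
      N[v]∖y≡ = trans (sym (regular v)) (countFin-∖-∈ n (N v) vy)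
      N[y]∖v∖u≡ : d ≡ suc (suc (countFin n (N y ∖ v ∖ u)))
      N[y]∖v∖u≡ = begin
        d                                     ≡⟨ sym (regular y) ⟩
        countFin n (N y)                      ≡⟨ countFin-∖-∈ n (N y) (Edge-sym vy) ⟩
        suc (countFin n (N y ∖ v))            ≡⟨ cong suc (countFin-∖-∈ n (N y ∖ v) (trans (∖-≢ (N y) u≢v) yu)) ⟩
        suc (suc (countFin n (N y ∖ v ∖ u)))  ∎
        where open ≡-Reasoning
      smaller : countFin n (N y ∖ v ∖ u) < countFin n (N v ∖ y)
      smaller = ≤-reflexive (suc-injective (trans (sym N[y]∖v∖u≡) N[v]∖y≡))
      outside : (∃ λ w → (N v ∖ y) w ≡ true × (N y ∖ v ∖ u) w ≡ false) →
                ∃ λ w → Edge G v w × w ≢ y × ¬ Edge G y w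
      outside (w , w∈ , w∉) with vw , w≢y ← ∈-∖ (N v) w∈ =
        w , vw , w≢y , ≡false⇒¬Edge (begin
        N y w            ≡⟨ sym (∖-≢ (N y) (≢-sym (Edge⇒≢ vw))) ⟩
        (N y ∖ v) w      ≡⟨ sym (∖-≢ (N y ∖ v) λ { refl → ¬vu vw }) ⟩
        (N y ∖ v ∖ u) w  ≡⟨ w∉ ⟩
        false            ∎)
        where open ≡-Reasoning

    ∃-neighbour-outside-N[x] : ∀ {v x y w} → Edge G v x → Edge G v y → Edge G x y →
                               Edge G v w → w ≢ y → ¬ Edge G y w →
                               ∃ λ z → Edge G w z × z ≢ v × z ≢ x × ¬ Edge G x z
    ∃-neighbour-outside-N[x] {v} {x} {y} {w} vx vy xy vw w≢y ¬yw = outside (countFin-<⇒∃ n smaller)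
      where
      N : Fin n → Fin n → Bool
      N = adj G
      k A B : ℕ
      k = b2n (N x w)
      A = countFin n (N w ∖ v ∖ x)
      B = countFin n (N x ∖ v ∖ y ∖ w)
      N[w]≡ : d ≡ suc (k + A)
      N[w]≡ = begin
        d
          ≡⟨ sym (regular w) ⟩
        countFin n (N w)
          ≡⟨ countFin-∖-∈ n (N w) (Edge-sym vw) ⟩
        suc (countFin n (N w ∖ v))
          ≡⟨ cong suc (countFin-∖ n (N w ∖ v) x) ⟩
        suc (b2n ((N w ∖ v) x) + A)
          ≡⟨ cong (λ b → suc (b2n b + A)) (trans (∖-≢ (N w) (≢-sym (Edge⇒≢ vx))) (Graph.sym G w x)) ⟩
        suc (k + A) ∎
        where open ≡-Reasoning
      N[x]≡ : d ≡ suc (suc (k + B))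
      N[x]≡ = begin
        d
          ≡⟨ sym (regular x) ⟩
        countFin n (N x)
          ≡⟨ countFin-∖-∈ n (N x) (Edge-sym vx) ⟩
        suc (countFin n (N x ∖ v))
          ≡⟨ cong suc (countFin-∖-∈ n (N x ∖ v) (trans (∖-≢ (N x) (≢-sym (Edge⇒≢ vy))) xy)) ⟩
        suc (suc (countFin n (N x ∖ v ∖ y)))
          ≡⟨ cong (λ m → suc (suc m)) (countFin-∖ n (N x ∖ v ∖ y) w) ⟩
        suc (suc (b2n ((N x ∖ v ∖ y) w) + B))
          ≡⟨ cong (λ b → suc (suc (b2n b + B))) (trans (∖-≢ (N x ∖ v) w≢y) (∖-≢ (N x) (≢-sym (Edge⇒≢ vw)))) ⟩
        suc (suc (k + B)) ∎
        where open ≡-Reasoning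
      smaller : B < A
      smaller = ≤-reflexive (+-cancelˡ-≡ k (suc B) A (suc-injective (begin
        suc (k + suc B)    ≡⟨ cong suc (+-suc k B) ⟩
        suc (suc (k + B))  ≡⟨ trans (sym N[x]≡) N[w]≡ ⟩
        suc (k + A)        ∎)))
        where open ≡-Reasoning
      outside : (∃ λ z → (N w ∖ v ∖ x) z ≡ true × (N x ∖ v ∖ y ∖ w) z ≡ false) →
                ∃ λ z → Edge G w z × z ≢ v × z ≢ x × ¬ Edge G x z
      outside (z , z∈ , z∉)
        with z∈N[w]∖v , z≢x ← ∈-∖ (N w ∖ v) z∈
        with wz , z≢v ← ∈-∖ (N w) z∈N[w]∖v =
        z , wz , z≢v , z≢x , ≡false⇒¬Edge (begin
        N x z                ≡⟨ sym (∖-≢ (N x) z≢v) ⟩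
        (N x ∖ v) z          ≡⟨ sym (∖-≢ (N x ∖ v) λ { refl → ¬yw (Edge-sym wz) }) ⟩
        (N x ∖ v ∖ y) z      ≡⟨ sym (∖-≢ (N x ∖ v ∖ y) (≢-sym (Edge⇒≢ wz))) ⟩
        (N x ∖ v ∖ y ∖ w) z  ≡⟨ z∉ ⟩
        false                ∎)
        where open ≡-Reasoning

samePair? : ∀ {n} (a b c d : Fin n) → Dec (SamePair a b c d)
samePair? a b c d = (a ≟ c ×-dec b ≟ d) ⊎-dec (a ≟ d ×-dec b ≟ c)

samePair?-swap : ∀ {n} (a b c d : Fin n) → does (samePair? a b c d) ≡ does (samePair? b a c d)
samePair?-swap a b c d = trans (∨-comm (does (a ≟ c) ∧ does (b ≟ d)) _)
  (cong₂ _∨_ (∧-comm (does (a ≟ d)) (does (b ≟ c))) (∧-comm (does (a ≟ c)) (does (b ≟ d))))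

SamePair-sym : ∀ {n} {a b c d : Fin n} → SamePair a b c d → SamePair c d a b
SamePair-sym (inj₁ (refl , refl)) = inj₁ (refl , refl)
SamePair-sym (inj₂ (refl , refl)) = inj₂ (refl , refl)

SamePair-trans : ∀ {n} {a b c d e f : Fin n} → SamePair a b c d → SamePair c d e f → SamePair a b e f
SamePair-trans (inj₁ (refl , refl)) cd≈ef = cd≈ef
SamePair-trans (inj₂ (refl , refl)) (inj₁ (refl , refl)) = inj₂ (refl , refl)
SamePair-trans (inj₂ (refl , refl)) (inj₂ (refl , refl)) = inj₁ (refl , refl)

SamePair-diag : ∀ {n} {a c d : Fin n} → SamePair a a c d → c ≡ d
SamePair-diag (inj₁ (refl , refl)) = refl
SamePair-diag (inj₂ (refl , refl)) = refl

≢⇒¬SamePair : ∀ {n} {a b c d : Fin n} → a ≢ c → a ≢ d → ¬ SamePair a b c d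
≢⇒¬SamePair a≢c a≢d (inj₁ (a≡c , _)) = a≢c a≡c
≢⇒¬SamePair a≢c a≢d (inj₂ (a≡d , _)) = a≢d a≡d

Edge-resp-SamePair : ∀ {n} (G : Graph n) {a b c d : Fin n} → SamePair a b c d → Edge G c d → Edge G a b
Edge-resp-SamePair G (inj₁ (refl , refl)) cd = cd
Edge-resp-SamePair G (inj₂ (refl , refl)) cd = Edge-sym G cd

pairWeight : ∀ {n} → (Fin n → Bool) → Fin n → Fin n → ℕ
pairWeight S a b = b2n ((toℕ a <ᵇ toℕ b) ∧ S a ∧ S b)

sumPairsIn : ∀ {n} → (Fin n → Bool) → (Fin n → Fin n → ℕ) → ℕ
sumPairsIn {n} S f = sumFin² n (λ a b → pairWeight S a b * f a b)

sumPairsIn-+ : ∀ {n} (S : Fin n → Bool) (f g : Fin n → Fin n → ℕ) →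
               sumPairsIn S (λ a b → f a b + g a b) ≡ sumPairsIn S f + sumPairsIn S g
sumPairsIn-+ {n} S f g = trans (sumFin²-cong n (λ a b → *-distribˡ-+ (pairWeight S a b) (f a b) (g a b)))
                                (sumFin²-+ n _ _)

pairWeight-swap : ∀ {n} (S : Fin n → Bool) {c d : Fin n} → c ≢ d →
                  pairWeight S c d + pairWeight S d c ≡ b2n (S c ∧ S d)
pairWeight-swap S {c} {d} c≢d = begin
  b2n (l ∧ s) + b2n (l′ ∧ S d ∧ S c)  ≡⟨ cong (λ t → b2n (l ∧ s) + b2n (l′ ∧ t)) (∧-comm (S d) (S c)) ⟩
  b2n (l ∧ s) + b2n (l′ ∧ s)          ≡⟨ cong₂ _+_ (b2n-∧ l s) (b2n-∧ l′ s) ⟩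
  b2n l * b2n s + b2n l′ * b2n s      ≡⟨ sym (*-distribʳ-+ (b2n s) (b2n l) (b2n l′)) ⟩
  (b2n l + b2n l′) * b2n s            ≡⟨ cong (_* b2n s) (b2n-<ᵇ-connex (toℕ c) (toℕ d) (c≢d ∘ toℕ-injective)) ⟩
  1 * b2n s                           ≡⟨ *-identityˡ (b2n s) ⟩
  b2n s                               ∎
  where
  open ≡-Reasoning
  l l′ s : Bool
  l = toℕ c <ᵇ toℕ d
  l′ = toℕ d <ᵇ toℕ c
  s = S c ∧ S d

orientations-disjoint : ∀ {n} {a b c d : Fin n} → c ≢ d →
  does (a ≟ c) ∧ does (b ≟ d) ≡ true → does (a ≟ d) ∧ does (b ≟ c) ≡ false
orientations-disjoint {a = a} {b} {c} {d} c≢d with a ≟ c | a ≟ d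
... | yes refl | yes refl = contradiction refl c≢d
... | yes _    | no _     = λ _ → refl
... | no _     | _        = λ ()

sumPairsIn-pair : ∀ {n} (S : Fin n → Bool) {c d : Fin n} → c ≢ d →
                  sumPairsIn S (λ a b → b2n (does (samePair? a b c d))) ≡ b2n (S c ∧ S d)
sumPairsIn-pair {n} S {c} {d} c≢d = begin
  sumPairsIn S (λ a b → b2n (does (samePair? a b c d)))
    ≡⟨ sumFin²-cong n split ⟩
  sumFin² n (λ a b → indicator a c * (indicator b d * w a b) + indicator a d * (indicator b c * w a b))
    ≡⟨ sumFin²-+ n _ _ ⟩
  sumFin² n (λ a b → indicator a c * (indicator b d * w a b))
    + sumFin² n (λ a b → indicator a d * (indicator b c * w a b))
    ≡⟨ cong₂ _+_ (sumFin²-indicator n c d w) (sumFin²-indicator n d c w) ⟩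
  w c d + w d c
    ≡⟨ pairWeight-swap S c≢d ⟩
  b2n (S c ∧ S d) ∎
  where
  open ≡-Reasoning
  w : Fin n → Fin n → ℕ
  w = pairWeight S
  rearrange : ∀ w p q r s → w * (p * q + r * s) ≡ p * (q * w) + r * (s * w)
  rearrange = solve-∀
  split : ∀ a b → w a b * b2n (does (samePair? a b c d))
                ≡ indicator a c * (indicator b d * w a b) + indicator a d * (indicator b c * w a b)
  split a b = begin
    w a b * b2n ((does (a ≟ c) ∧ does (b ≟ d)) ∨ (does (a ≟ d) ∧ does (b ≟ c)))
      ≡⟨ cong (w a b *_) (b2n-∨ _ _ (orientations-disjoint {a = a} {b} c≢d)) ⟩
    w a b * (b2n (does (a ≟ c) ∧ does (b ≟ d)) + b2n (does (a ≟ d) ∧ does (b ≟ c)))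
      ≡⟨ cong (w a b *_) (cong₂ _+_ (b2n-∧ (does (a ≟ c)) (does (b ≟ d)))
                                     (b2n-∧ (does (a ≟ d)) (does (b ≟ c)))) ⟩
    w a b * (indicator a c * indicator b d + indicator a d * indicator b c)
      ≡⟨ rearrange (w a b) (indicator a c) (indicator b d) (indicator a d) (indicator b c) ⟩
    indicator a c * (indicator b d * w a b) + indicator a d * (indicator b c * w a b) ∎

sumPairsIn-pairs : ∀ {n} (S : Fin n → Bool) {p q r s : Fin n} → p ≢ q → r ≢ s → ¬ SamePair p q r s →
  sumPairsIn S (λ a b → b2n (does (samePair? a b p q ⊎-dec samePair? a b r s)))
    ≡ b2n (S p ∧ S q) + b2n (S r ∧ S s)
sumPairsIn-pairs {n} S {p} {q} {r} {s} p≢q r≢s pq≉rs = begin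
  sumPairsIn S (λ a b → b2n (does (samePair? a b p q ⊎-dec samePair? a b r s)))
    ≡⟨ sumFin²-cong n (λ a b → cong (pairWeight S a b *_) (b2n-∨ _ _ (disjoint a b))) ⟩
  sumPairsIn S (λ a b → b2n (does (samePair? a b p q)) + b2n (does (samePair? a b r s)))
    ≡⟨ sumPairsIn-+ S _ _ ⟩
  sumPairsIn S (λ a b → b2n (does (samePair? a b p q)))
    + sumPairsIn S (λ a b → b2n (does (samePair? a b r s)))
    ≡⟨ cong₂ _+_ (sumPairsIn-pair S p≢q) (sumPairsIn-pair S r≢s) ⟩
  b2n (S p ∧ S q) + b2n (S r ∧ S s) ∎
  where
  open ≡-Reasoning
  disjoint : ∀ a b → does (samePair? a b p q) ≡ true → does (samePair? a b r s) ≡ false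
  disjoint a b ab≈pq = dec-false (samePair? a b r s)
    (λ ab≈rs → pq≉rs (SamePair-trans (SamePair-sym (does⇒witness (samePair? a b p q) ab≈pq)) ab≈rs))

sumPairsIn-congˡ : ∀ {n} {S S′ : Fin n → Bool} (f : Fin n → Fin n → ℕ) → (∀ a → S a ≡ S′ a) →
                   sumPairsIn S f ≡ sumPairsIn S′ f
sumPairsIn-congˡ {n} f S≗S′ = sumFin²-cong n λ a b →
  cong (λ t → b2n t * f a b) (cong₂ (λ p q → (toℕ a <ᵇ toℕ b) ∧ p ∧ q) (S≗S′ a) (S≗S′ b))

edgesInNbhd≡sumPairsIn : ∀ {n} (G : Graph n) v →
                         edgesInNbhd G v ≡ sumPairsIn (adj G v) (λ a b → b2n (adj G a b))
edgesInNbhd≡sumPairsIn {n} G v = sumFin²-cong n regroup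
  where
  regroup : ∀ a b → b2n ((toℕ a <ᵇ toℕ b) ∧ adj G v a ∧ adj G v b ∧ adj G a b)
                  ≡ pairWeight (adj G v) a b * b2n (adj G a b)
  regroup a b = trans (cong b2n (sym (trans (∧-assoc l (S a ∧ S b) (adj G a b))
                                            (cong (l ∧_) (∧-assoc (S a) (S b) (adj G a b))))))
                      (b2n-∧ (l ∧ S a ∧ S b) (adj G a b))
    where
    l : Bool
    l = toℕ a <ᵇ toℕ b
    S : Fin n → Bool
    S = adj G v

module Switch {n} (G : Graph n) {d₁a d₁b d₂a d₂b i₁a i₁b i₂a i₂b : Fin n}
  (d₁∈G : Edge G d₁a d₁b) (d₂∈G : Edge G d₂a d₂b) (i₁∉G : ¬ Edge G i₁a i₁b) (i₂∉G : ¬ Edge G i₂a i₂b)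
  (i₁a≢i₁b : i₁a ≢ i₁b) (i₂a≢i₂b : i₂a ≢ i₂b)
  (d₁≉d₂ : ¬ SamePair d₁a d₁b d₂a d₂b) (i₁≉i₂ : ¬ SamePair i₁a i₁b i₂a i₂b) where

  Deleted Inserted : Fin n → Fin n → Set
  Deleted  a b = SamePair a b d₁a d₁b ⊎ SamePair a b d₂a d₂b
  Inserted a b = SamePair a b i₁a i₁b ⊎ SamePair a b i₂a i₂b

  deleted? : ∀ a b → Dec (Deleted a b)
  deleted? a b = samePair? a b d₁a d₁b ⊎-dec samePair? a b d₂a d₂b

  inserted? : ∀ a b → Dec (Inserted a b)
  inserted? a b = samePair? a b i₁a i₁b ⊎-dec samePair? a b i₂a i₂b

  switchedAdj : Fin n → Fin n → Bool
  switchedAdj a b = (adj G a b ∧ not (does (deleted? a b))) ∨ does (inserted? a b)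

  switched : Graph n
  switched = record { adj = switchedAdj ; sym = switchedAdj-sym ; irrefl = switchedAdj-irrefl }
    where
    switchedAdj-sym : ∀ a b → switchedAdj a b ≡ switchedAdj b a
    switchedAdj-sym a b = cong₂ _∨_
      (cong₂ (λ e p → e ∧ not p) (Graph.sym G a b)
             (cong₂ _∨_ (samePair?-swap a b d₁a d₁b) (samePair?-swap a b d₂a d₂b)))
      (cong₂ _∨_ (samePair?-swap a b i₁a i₁b) (samePair?-swap a b i₂a i₂b))
    switchedAdj-irrefl : ∀ a → switchedAdj a a ≡ false
    switchedAdj-irrefl a = cong₂ (λ e p → (e ∧ not (does (deleted? a a))) ∨ p) (Graph.irrefl G a)
      (cong₂ _∨_ (dec-false (samePair? a a i₁a i₁b) (i₁a≢i₁b ∘ SamePair-diag))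
                 (dec-false (samePair? a a i₂a i₂b) (i₂a≢i₂b ∘ SamePair-diag)))

  Deleted⇒Edge : ∀ {a b} → Deleted a b → Edge G a b
  Deleted⇒Edge (inj₁ ab≈d₁) = Edge-resp-SamePair G ab≈d₁ d₁∈G
  Deleted⇒Edge (inj₂ ab≈d₂) = Edge-resp-SamePair G ab≈d₂ d₂∈G

  Inserted⇒¬Edge : ∀ {a b} → Inserted a b → ¬ Edge G a b
  Inserted⇒¬Edge (inj₁ ab≈i₁) ab = i₁∉G (Edge-resp-SamePair G (SamePair-sym ab≈i₁) ab)
  Inserted⇒¬Edge (inj₂ ab≈i₂) ab = i₂∉G (Edge-resp-SamePair G (SamePair-sym ab≈i₂) ab)

  switched-inserted : ∀ {a b} → Inserted a b → Edge switched a b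
  switched-inserted {a} {b} ins rewrite dec-true (inserted? a b) ins = ∨-zeroʳ _

  switched-deleted : ∀ {a b} → Deleted a b → ¬ Edge switched a b
  switched-deleted {a} {b} del
    rewrite dec-true (deleted? a b) del
          | dec-false (inserted? a b) (λ ins → Inserted⇒¬Edge ins (Deleted⇒Edge del))
          | ∧-zeroʳ (adj G a b) = λ ()

  switched-unchanged : ∀ {a b} → ¬ Deleted a b → ¬ Inserted a b → adj switched a b ≡ adj G a b
  switched-unchanged {a} {b} ¬del ¬ins
    rewrite dec-false (deleted? a b) ¬del | dec-false (inserted? a b) ¬ins
    = trans (∨-identityʳ _) (∧-identityʳ _)

  switched-replaces : Replace G switched d₁a d₁b d₂a d₂b i₁a i₁b i₂a i₂b
  switched-replaces a b = forward (inserted? a b) (deleted? a b) , backward (inserted? a b)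
    where
    forward : Dec (Inserted a b) → Dec (Deleted a b) → Edge switched a b →
              (Edge G a b × ¬ SamePair a b d₁a d₁b × ¬ SamePair a b d₂a d₂b) ⊎ Inserted a b
    forward (yes ins) _         _  = inj₂ ins
    forward (no ¬ins) (yes del) ab = contradiction ab (switched-deleted del)
    forward (no ¬ins) (no ¬del) ab =
      inj₁ (trans (sym (switched-unchanged ¬del ¬ins)) ab , ¬del ∘ inj₁ , ¬del ∘ inj₂)
    backward : Dec (Inserted a b) →
               (Edge G a b × ¬ SamePair a b d₁a d₁b × ¬ SamePair a b d₂a d₂b) ⊎ Inserted a b →
               Edge switched a b
    backward _         (inj₂ ins)              = switched-inserted ins
    backward (yes ins) (inj₁ _)                = switched-inserted ins
    backward (no ¬ins) (inj₁ (ab , ¬d₁ , ¬d₂)) =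
      trans (switched-unchanged [ ¬d₁ , ¬d₂ ] ¬ins) ab

  sumPairsIn-switched : ∀ S →
    sumPairsIn S (λ a b → b2n (adj switched a b)) + (b2n (S d₁a ∧ S d₁b) + b2n (S d₂a ∧ S d₂b))
      ≡ sumPairsIn S (λ a b → b2n (adj G a b)) + (b2n (S i₁a ∧ S i₁b) + b2n (S i₂a ∧ S i₂b))
  sumPairsIn-switched S = begin
    sumPairsIn S (λ a b → b2n (adj switched a b)) + (b2n (S d₁a ∧ S d₁b) + b2n (S d₂a ∧ S d₂b))
      ≡⟨ cong (sumPairsIn S (λ a b → b2n (adj switched a b)) +_)
              (sym (sumPairsIn-pairs S (Edge⇒≢ G d₁∈G) (Edge⇒≢ G d₂∈G) d₁≉d₂)) ⟩
    sumPairsIn S (λ a b → b2n (adj switched a b)) + sumPairsIn S (λ a b → b2n (does (deleted? a b)))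
      ≡⟨ sym (sumPairsIn-+ S _ _) ⟩
    sumPairsIn S (λ a b → b2n (adj switched a b) + b2n (does (deleted? a b)))
      ≡⟨ sumFin²-cong n (λ a b → cong (pairWeight S a b *_) (pointwise a b)) ⟩
    sumPairsIn S (λ a b → b2n (adj G a b) + b2n (does (inserted? a b)))
      ≡⟨ sumPairsIn-+ S _ _ ⟩
    sumPairsIn S (λ a b → b2n (adj G a b)) + sumPairsIn S (λ a b → b2n (does (inserted? a b)))
      ≡⟨ cong (sumPairsIn S (λ a b → b2n (adj G a b)) +_)
              (sumPairsIn-pairs S i₁a≢i₁b i₂a≢i₂b i₁≉i₂) ⟩
    sumPairsIn S (λ a b → b2n (adj G a b)) + (b2n (S i₁a ∧ S i₁b) + b2n (S i₂a ∧ S i₂b)) ∎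
    where
    open ≡-Reasoning
    pointwise : ∀ a b → b2n (adj switched a b) + b2n (does (deleted? a b))
                      ≡ b2n (adj G a b) + b2n (does (inserted? a b))
    pointwise a b = b2n-switch (adj G a b) (does (deleted? a b)) (does (inserted? a b))
      (Deleted⇒Edge ∘ does⇒witness (deleted? a b))
      (λ ins → ¬-not (Inserted⇒¬Edge (does⇒witness (inserted? a b) ins)))

AtDist₂⇒≢ : ∀ {n} {G : Graph n} {v u : Fin n} → AtDist G v 2 u → u ≢ v
AtDist₂⇒≢ (_ , not-closer) refl = not-closer 0 (s≤s z≤n) here

AtDist₂⇒¬Edge : ∀ {n} {G : Graph n} {v u : Fin n} → AtDist G v 2 u → ¬ Edge G v u
AtDist₂⇒¬Edge (_ , not-closer) vu = not-closer 1 (s≤s (s≤s z≤n)) (step vu here)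

module TriangleSwitch {n} (G : Graph n) {v x y w z : Fin n}
  (vx : Edge G v x) (vy : Edge G v y) (xy : Edge G x y) (vw : Edge G v w) (wz : Edge G w z)
  (w≢y : w ≢ y) (¬yw : ¬ Edge G y w) (z≢v : z ≢ v) (z≢x : z ≢ x) (¬xz : ¬ Edge G x z) where

  v≢x : v ≢ x
  v≢x = Edge⇒≢ G vx
  v≢y : v ≢ y
  v≢y = Edge⇒≢ G vy
  v≢w : v ≢ w
  v≢w = Edge⇒≢ G vw
  x≢y : x ≢ y
  x≢y = Edge⇒≢ G xy
  w≢z : w ≢ z
  w≢z = Edge⇒≢ G wz
  w≢x : w ≢ x
  w≢x refl = ¬yw (Edge-sym G xy)
  y≢z : y ≢ z
  y≢z refl = ¬yw (Edge-sym G wz)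

  open Switch G (Edge-sym G xy) wz ¬yw ¬xz (≢-sym w≢y) (≢-sym z≢x)
    (≢⇒¬SamePair (≢-sym w≢y) y≢z) (≢⇒¬SamePair (≢-sym x≢y) y≢z) public

  Δ⁻ : DeltaMinus G switched
  Δ⁻ = v , y , w , x , z
     , (v≢y , v≢w , v≢x , ≢-sym z≢v , ≢-sym w≢y , ≢-sym x≢y , y≢z , w≢x , w≢z , ≢-sym z≢x)
     , vy , Edge-sym G xy , Edge-sym G vx , wz , ¬yw , ¬xz , switched-replaces

  N[v]-unchanged : ∀ u → adj switched v u ≡ adj G v u
  N[v]-unchanged u = switched-unchanged
    [ ≢⇒¬SamePair v≢y v≢x , ≢⇒¬SamePair v≢w (≢-sym z≢v) ]
    [ ≢⇒¬SamePair v≢y v≢w , ≢⇒¬SamePair v≢x (≢-sym z≢v) ]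

  V₂-unchanged : ∀ {a b} → AtDist G v 2 a → AtDist G v 2 b → adj switched a b ≡ adj G a b
  V₂-unchanged a∈V₂ b∈V₂ = switched-unchanged
    [ avoids vy , avoids vw ] [ avoids vy , avoids vx ]
    where
    avoids : ∀ {c d} → Edge G v c → ¬ SamePair _ _ c d
    avoids vc ab≈cd = ≢⇒¬SamePair (λ { refl → AtDist₂⇒¬Edge a∈V₂ vc })
                                  (λ { refl → AtDist₂⇒¬Edge b∈V₂ vc })
                                  (SamePair-sym ab≈cd)

  ¬xy : ¬ Edge switched x y
  ¬xy = switched-deleted (inj₁ (inj₂ (refl , refl)))

  edgesInNbhd-preserved : edgesInNbhd switched v ≡ edgesInNbhd G v
  edgesInNbhd-preserved = begin
    edgesInNbhd switched v  ≡⟨ edgesInNbhd≡sumPairsIn switched v ⟩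
    E′′                     ≡⟨ sumPairsIn-congˡ _ N[v]-unchanged ⟩
    E′                      ≡⟨ +-cancelʳ-≡ (1 + b2n (S z)) E′ E switch-count ⟩
    E                       ≡⟨ sym (edgesInNbhd≡sumPairsIn G v) ⟩
    edgesInNbhd G v         ∎
    where
    open ≡-Reasoning
    S : Fin n → Bool
    S = adj G v
    E′′ E′ E : ℕ
    E′′ = sumPairsIn (adj switched v) (λ a b → b2n (adj switched a b))
    E′ = sumPairsIn S (λ a b → b2n (adj switched a b))
    E = sumPairsIn S (λ a b → b2n (adj G a b))
    switch-count : E′ + (1 + b2n (S z)) ≡ E + (1 + b2n (S z))
    switch-count = begin
      E′ + (1 + b2n (S z))
        ≡⟨ cong (E′ +_) (cong₂ (λ p q → b2n p + b2n q) (cong₂ _∧_ vy vx) (cong (_∧ S z) vw)) ⟨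
      E′ + (b2n (S y ∧ S x) + b2n (S w ∧ S z))
        ≡⟨ sumPairsIn-switched S ⟩
      E + (b2n (S y ∧ S w) + b2n (S x ∧ S z))
        ≡⟨ cong (E +_) (cong₂ (λ p q → b2n p + b2n q) (cong₂ _∧_ vy vw) (cong (_∧ S z) vx)) ⟩
      E + (1 + b2n (S z)) ∎

lemma3p6 : (d : ℕ) → d ≥ 3 → (n : ℕ) → (G : Graph n) → Regular G d →
    (v x y : Fin n) → Edge G v x → Edge G v y → Edge G x y →
    (Σ (Fin n) λ u → Edge G y u × AtDist G v 2 u) →
    Σ (Graph n) λ G' →
        DeltaSwitch G G'
      × (∀ u → Edge G v u ⇔ Edge G' v u)
      × ¬ Edge G' x y
      × (∀ a b → AtDist G v 2 a → AtDist G v 2 b → Edge G a b ⇔ Edge G' a b)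
      × edgesInNbhd G' v ≥ edgesInNbhd G v
lemma3p6 d _ n G regular v x y vx vy xy (u , yu , u∈V₂)
  with w , vw , w≢y , ¬yw ←
         ∃-neighbour-outside-N[y] G regular vy yu (AtDist₂⇒≢ u∈V₂) (AtDist₂⇒¬Edge u∈V₂)
  with z , wz , z≢v , z≢x , ¬xz ← ∃-neighbour-outside-N[x] G regular vx vy xy vw w≢y ¬yw
  = switched , inj₂ Δ⁻ , (λ u → ≡⇒⇔ (N[v]-unchanged u)) , ¬xy
  , (λ a b a∈V₂ b∈V₂ → ≡⇒⇔ (V₂-unchanged a∈V₂ b∈V₂)) , ≤-reflexive (sym edgesInNbhd-preserved)
  where
  open TriangleSwitch G vx vy xy vw wz w≢y ¬yw z≢v z≢x ¬xz
  ≡⇒⇔ : ∀ {p q : Bool} → p ≡ q → q ≡ true ⇔ p ≡ true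
  ≡⇒⇔ p≡q = mk⇔ (trans p≡q) (trans (sym p≡q))
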